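{- Let $\mathcal{D}$ be a finite structure. Any two $U$-$X$-cores of $\mathcal{D}$ are isomorphic.
   Context: Structures are finite relational structures with nonempty domain $D$. A shop of $D$ is a map $f$ from $D$ to the power set of $D$ with $f(d)\neq\emptyset$ for all $d$ and $\bigcup_d f(d)=D$; it is a surjective hyper-endomorphism of $\mathcal{D}$ if for each relation $R$ of arity $i$, $R(a_1,\dots,a_i)$ in $\mathcal{D}$ implies $R(b_1,\dots,b_i)$ in $\mathcal{D}$ for all $b_j\in f(a_j)$. For $S\subseteq D$, $f(S)=\bigcup_{s\in S}f(s)$; $f$ is $U$-surjective if $f(U)=D$ and $X$-total if $f(d)\cap X\ne\emptyset$ for every $d\in D$. $U$-$X$-core: choose $U\subseteq D$ of minimum cardinality such that $\mathcal{D}$ has a $U$-surjective surjective hyper-endomorphism and $X\subseteq D$ of minimum cardinality such that $\mathcal{D}$ has an $X$-total surjective hyper-endomorphism, and among all such choices take one with $|U\cap X|$ maximum; the substructure of $\mathcal{D}$ induced by $U\cup X$ is called a $U$-$X$-core of $\mathcal{D}$. -}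

module Defs where

open import Data.Nat using (ℕ; _≤_)
open import Data.Bool using (Bool; true)
open import Data.Fin using (Fin)
open import Data.Fin.Subset using (Subset; _∈_; Nonempty; ∣_∣; _∩_; _∪_)
open import Data.Vec using (Vec; lookup; map)
open import Data.Product using (Σ; ∃; _×_; proj₁)
open import Relation.Binary.PropositionalEquality using (_≡_)

record Structure (n : ℕ) : Set where
  field
    m     : ℕ
    arity : Fin m → ℕ
    rel   : (r : Fin m) → Vec (Fin n) (arity r) → Bool
open Structure public

module _ {n : ℕ} (𝒟 : Structure n) where

  IsShop : (Fin n → Subset n) → Set
  IsShop f = (∀ d → Nonempty (f d)) × (∀ d → ∃ λ e → d ∈ f e)

  IsSHE : (Fin n → Subset n) → Set
  IsSHE f = IsShop f ×
    (∀ (r : Fin (m 𝒟)) (a b : Vec (Fin n) (arity 𝒟 r)) →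
       rel 𝒟 r a ≡ true →
       (∀ j → lookup b j ∈ f (lookup a j)) →
       rel 𝒟 r b ≡ true)

  USurjective : (Fin n → Subset n) → Subset n → Set
  USurjective f U = ∀ d → ∃ λ u → u ∈ U × d ∈ f u

  XTotal : (Fin n → Subset n) → Subset n → Set
  XTotal f X = ∀ d → ∃ λ x → x ∈ X × x ∈ f d

  HasUSurjSHE : Subset n → Set
  HasUSurjSHE U = ∃ λ f → IsSHE f × USurjective f U

  HasXTotalSHE : Subset n → Set
  HasXTotalSHE X = ∃ λ f → IsSHE f × XTotal f X

  MinU : Subset n → Set
  MinU U = HasUSurjSHE U × (∀ U′ → HasUSurjSHE U′ → ∣ U ∣ ≤ ∣ U′ ∣)

  MinX : Subset n → Set
  MinX X = HasXTotalSHE X × (∀ X′ → HasXTotalSHE X′ → ∣ X ∣ ≤ ∣ X′ ∣)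

  -- (U , X) is an admissible choice defining a U-X-core (induced by U ∪ X)
  IsUXChoice : Subset n → Subset n → Set
  IsUXChoice U X = MinU U × MinX X ×
    (∀ U′ X′ → MinU U′ → MinX X′ → ∣ U′ ∩ X′ ∣ ≤ ∣ U ∩ X ∣)

  El : Subset n → Set
  El S = Σ (Fin n) (λ d → d ∈ S)

  record InducedIso (S T : Subset n) : Set where
    field
      to      : El S → El T
      from    : El T → El S
      from-to : ∀ x → proj₁ (from (to x)) ≡ proj₁ x
      to-from : ∀ y → proj₁ (to (from y)) ≡ proj₁ y
      preserves : ∀ (r : Fin (m 𝒟)) (a : Vec (El S) (arity 𝒟 r)) →
        rel 𝒟 r (map proj₁ a) ≡ rel 𝒟 r (map (λ x → proj₁ (to x)) a)

-- Compose a U-surjective SHE of one choice with an X′-total SHE of the other: the result s is an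
-- SHE that is U-surjective and X′-total. Minimality of U and U′ forces every u ∈ U to have exactly
-- one s-image in U′, and these are distinct; minimality of X makes any choice of s-images of the
-- points of X injective; maximality of ∣ U ∩ X ∣ forbids sending a point of X ∖ U into U′. This
-- yields an injection U ∪ X → U′ ∪ X′ selecting from s, and symmetrically one back. Their
-- composite permutes U ∪ X while selecting from an SHE, so its (n !)-th power is the identity and
-- preserves relations; hence the forward injection also reflects them and is an isomorphism.
module Submission where

open import Defs
open import Data.Nat using (ℕ; _<_)
open import Data.Fin.Subset using (Subset; _∪_)

open import Data.Bool using (true)
open import Data.Bool.Properties using (T-≡; ⇔→≡)
open import Data.Fin using (Fin; zero; suc; toℕ; _≟_)
open import Data.Fin.Properties using (any?; pigeonhole; toℕ≤pred[n])
open import Data.Fin.Subset using (_∈_; _∉_; _⊆_; _⊂_; _∩_; _-_; ⁅_⁆; ∣_∣; Nonempty; inside; outside)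
open import Data.Fin.Subset.Induction using (⊂-wellFounded; Acc; acc)
open import Data.Fin.Subset.Properties
  using ( _∈?_; nonempty?; Empty-unique; ∣⊥∣≡0; p⊆q⇒∣p∣≤∣q∣; p⊂q⇒∣p∣<∣q∣
        ; x∈p∧x≢y⇒x∈p-y; x∈p⇒p-x⊂p; x∈p⇒∣p-x∣<∣p∣; p─q⊆p; p─⊥≡p; x∈⁅x⁆; x∈⁅y⁆⇒x≡y
        ; x∈p∩q⁺; x∈p∩q⁻; x∈p∪q⁺; x∈p∪q⁻; p⊆p∪q )
open import Data.Nat using (zero; suc; _≤_; _+_; _*_; _∸_; z≤n; s≤s; _!; pred)
open import Data.Nat.Properties
  using ( ≤-trans; ≤-reflexive; <⇒≱; m≤n⇒m≤1+n
        ; <⇒≤; m<n⇒0<n∸m; m∸n≤m; suc-pred; _!≢0; n<1+n; m∸n+n≡m; module ≤-Reasoning )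
open import Data.Nat.Divisibility using (divides; ∣-trans; m∣m*n; m≤n⇒m!∣n!)
open import Data.Nat.GeneralisedArithmetic using (iterate)
open import Data.Product using (∃; _×_; _,_; proj₁; proj₂)
open import Data.Sum using (inj₁; inj₂)
open import Data.Vec using (Vec; _∷_; there; lookup; map; tabulate)
open import Data.Vec.Properties using (lookup∘tabulate; lookup⇒[]=; []=⇒lookup; lookup-map; map-∘; map-cong)
open import Function using (_∘_)
open import Function.Bundles using (Equivalence; mk⇔)
open import Relation.Nullary using (yes; no; isYes; ¬_; contradiction)
open import Relation.Nullary.Decidable using (toWitness; fromWitness; _×-dec_; decidable-stable; toSum)
open import Relation.Unary using (Decidable)
open import Relation.Binary.PropositionalEquality

private
  variable
    n : ℕ

⟦_⟧ : {P : Fin n → Set} → Decidable P → Subset n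
⟦ P? ⟧ = tabulate (λ x → isYes (P? x))

module _ {P : Fin n → Set} (P? : Decidable P) {x : Fin n} where

  ∈⟦⟧⁺ : P x → x ∈ ⟦ P? ⟧
  ∈⟦⟧⁺ px = lookup⇒[]= x _ (trans (lookup∘tabulate _ x) (Equivalence.to T-≡ (fromWitness px)))

  ∈⟦⟧⁻ : x ∈ ⟦ P? ⟧ → P x
  ∈⟦⟧⁻ x∈ = toWitness {a? = P? x}
    (Equivalence.from T-≡ (trans (sym (lookup∘tabulate _ x)) ([]=⇒lookup x∈)))

choose : {P : Fin n → Set} → Decidable P → Fin n → Fin n
choose P? d with any? P?
... | yes (x , _) = x
... | no _        = d

choose-satisfies : {P : Fin n → Set} (P? : Decidable P) (d : Fin n) → ∃ P → P (choose P? d)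
choose-satisfies P? d ∃P with any? P?
... | yes (_ , px) = px
... | no ¬∃P       = contradiction ∃P ¬∃P

MapsTo : (Fin n → Fin n) → Subset n → Subset n → Set
MapsTo ψ S T = ∀ {x} → x ∈ S → ψ x ∈ T

InjectiveOn : (Fin n → Fin n) → Subset n → Set
InjectiveOn ψ S = ∀ {x y} → x ∈ S → y ∈ S → ψ x ≡ ψ y → x ≡ y

image : (Fin n → Fin n) → Subset n → Subset n
image ψ S = ⟦ (λ y → any? (λ x → (x ∈? S) ×-dec (ψ x ≟ y))) ⟧

∈-image⁺ : ∀ ψ (S : Subset n) {x} → x ∈ S → ψ x ∈ image ψ S
∈-image⁺ ψ S {x} x∈S = ∈⟦⟧⁺ _ (x , x∈S , refl)

∈-image⁻ : ∀ ψ (S : Subset n) {y} → y ∈ image ψ S → ∃ λ x → x ∈ S × ψ x ≡ y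
∈-image⁻ ψ S = ∈⟦⟧⁻ _

x∈p-y⇒x≢y : ∀ (p : Subset n) {x y} → x ∈ p - y → x ≢ y
x∈p-y⇒x≢y (_ ∷ p) {suc x} {suc y} (there x∈) refl = x∈p-y⇒x≢y p x∈ refl

∣p∣≤1+∣p-x∣ : ∀ (p : Subset n) x → ∣ p ∣ ≤ suc ∣ p - x ∣
∣p∣≤1+∣p-x∣ (inside  ∷ p) zero    = s≤s (≤-reflexive (cong ∣_∣ (sym (p─⊥≡p p))))
∣p∣≤1+∣p-x∣ (outside ∷ p) zero    = m≤n⇒m≤1+n (≤-reflexive (cong ∣_∣ (sym (p─⊥≡p p))))
∣p∣≤1+∣p-x∣ (inside  ∷ p) (suc x) = s≤s (∣p∣≤1+∣p-x∣ p x)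
∣p∣≤1+∣p-x∣ (outside ∷ p) (suc x) = ∣p∣≤1+∣p-x∣ p x

injectiveOn⇒∣p∣≤∣q∣ : ∀ {ψ : Fin n → Fin n} {S T : Subset n} →
                      MapsTo ψ S T → InjectiveOn ψ S → ∣ S ∣ ≤ ∣ T ∣
injectiveOn⇒∣p∣≤∣q∣ {n} {ψ} {S} = go (⊂-wellFounded S)
  where
  go : ∀ {S T : Subset n} → Acc _⊂_ S → MapsTo ψ S T → InjectiveOn ψ S → ∣ S ∣ ≤ ∣ T ∣
  go {S} {T} (acc smaller) maps inj with nonempty? S
  ... | no S-empty    = ≤-trans (≤-reflexive (trans (cong ∣_∣ (Empty-unique S-empty)) (∣⊥∣≡0 n))) z≤n
  ... | yes (x , x∈S) = begin
      ∣ S ∣            ≤⟨ ∣p∣≤1+∣p-x∣ S x ⟩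
      suc ∣ S - x ∣    ≤⟨ s≤s (go (smaller (x∈p⇒p-x⊂p x∈S)) maps′ inj′) ⟩
      suc ∣ T - ψ x ∣  ≤⟨ x∈p⇒∣p-x∣<∣p∣ (maps x∈S) ⟩
      ∣ T ∣            ∎
    where
    open ≤-Reasoning
    ⊆S : S - x ⊆ S
    ⊆S = p─q⊆p S ⁅ x ⁆
    maps′ : MapsTo ψ (S - x) (T - ψ x)
    maps′ y∈ = x∈p∧x≢y⇒x∈p-y (maps (⊆S y∈)) (x∈p-y⇒x≢y S y∈ ∘ inj (⊆S y∈) x∈S)
    inj′ : InjectiveOn ψ (S - x)
    inj′ a∈ b∈ = inj (⊆S a∈) (⊆S b∈)

p⊆q∧∣q∣≤∣p∣⇒q⊆p : ∀ {p q : Subset n} → p ⊆ q → ∣ q ∣ ≤ ∣ p ∣ → q ⊆ p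
p⊆q∧∣q∣≤∣p∣⇒q⊆p {p = p} p⊆q ∣q∣≤∣p∣ {x} x∈q with x ∈? p
... | yes x∈p = x∈p
... | no  x∉p = contradiction ∣q∣≤∣p∣ (<⇒≱ (p⊂q⇒∣p∣<∣q∣ (p⊆q , x , x∈q , x∉p)))

∣image∣≤∣p∣ : ∀ ψ (S : Subset n) → ∣ image ψ S ∣ ≤ ∣ S ∣
∣image∣≤∣p∣ {n} ψ S = injectiveOn⇒∣p∣≤∣q∣ {ψ = preimage} (proj₁ ∘ preimage-spec)
  (λ a∈ b∈ eq → trans (sym (proj₂ (preimage-spec a∈))) (trans (cong ψ eq) (proj₂ (preimage-spec b∈))))
  where
  preimage : Fin n → Fin n
  preimage y = choose (λ x → (x ∈? S) ×-dec (ψ x ≟ y)) y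
  preimage-spec : ∀ {y} → y ∈ image ψ S → preimage y ∈ S × ψ (preimage y) ≡ y
  preimage-spec {y} y∈ = choose-satisfies _ y (∈-image⁻ ψ S y∈)

∣p∣≤∣image∣⇒injectiveOn : ∀ {ψ} {S : Subset n} → ∣ S ∣ ≤ ∣ image ψ S ∣ → InjectiveOn ψ S
∣p∣≤∣image∣⇒injectiveOn {ψ = ψ} {S} ∣S∣≤ {a} {b} a∈S b∈S ψa≡ψb with a ≟ b
... | yes a≡b = a≡b
... | no  a≢b = contradiction ∣S∣≤ (<⇒≱ (begin-strict
      ∣ image ψ S ∣        ≤⟨ p⊆q⇒∣p∣≤∣q∣ image⊆ ⟩
      ∣ image ψ (S - b) ∣  ≤⟨ ∣image∣≤∣p∣ ψ (S - b) ⟩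
      ∣ S - b ∣            <⟨ x∈p⇒∣p-x∣<∣p∣ b∈S ⟩
      ∣ S ∣                ∎))
  where
  open ≤-Reasoning
  -- a still represents ψ b once b is removed
  image⊆ : image ψ S ⊆ image ψ (S - b)
  image⊆ y∈ with ∈-image⁻ ψ S y∈
  ... | x , x∈S , refl with x ≟ b
  ...   | yes refl = subst (_∈ image ψ (S - b)) ψa≡ψb (∈-image⁺ ψ (S - b) (x∈p∧x≢y⇒x∈p-y a∈S a≢b))
  ...   | no  x≢b  = ∈-image⁺ ψ (S - b) (x∈p∧x≢y⇒x∈p-y x∈S x≢b)

injectiveOn∧∣q∣≤∣p∣⇒q⊆image : ∀ {ψ} {S T : Subset n} → MapsTo ψ S T → InjectiveOn ψ S →
                              ∣ T ∣ ≤ ∣ S ∣ → T ⊆ image ψ S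
injectiveOn∧∣q∣≤∣p∣⇒q⊆image {ψ = ψ} {S} {T} maps inj ∣T∣≤∣S∣ =
  p⊆q∧∣q∣≤∣p∣⇒q⊆p image⊆T (≤-trans ∣T∣≤∣S∣ (injectiveOn⇒∣p∣≤∣q∣ (∈-image⁺ ψ S) inj))
  where
  image⊆T : image ψ S ⊆ T
  image⊆T y∈ with ∈-image⁻ ψ S y∈
  ... | _ , x∈S , refl = maps x∈S

iterate-+ : ∀ {A : Set} (f : A → A) x a k → iterate f x (a + k) ≡ iterate f (iterate f x a) k
iterate-+ f x zero    k = refl
iterate-+ f x (suc a) k = iterate-+ f (f x) a k

iterate-* : ∀ {A : Set} (f : A → A) x k → iterate f x k ≡ x → ∀ q → iterate f x (q * k) ≡ x
iterate-* f x k fix zero    = refl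
iterate-* f x k fix (suc q) = begin
  iterate f x (k + q * k)            ≡⟨ iterate-+ f x k (q * k) ⟩
  iterate f (iterate f x k) (q * k)  ≡⟨ cong (λ y → iterate f y (q * k)) fix ⟩
  iterate f x (q * k)                ≡⟨ iterate-* f x k fix q ⟩
  x                                  ∎
  where open ≡-Reasoning

module _ {n : ℕ} {π : Fin n → Fin n} {C : Subset n} (maps : MapsTo π C C) (inj : InjectiveOn π C) where

  iterate-mapsTo : ∀ k → MapsTo (λ x → iterate π x k) C C
  iterate-mapsTo zero    x∈C = x∈C
  iterate-mapsTo (suc k) x∈C = iterate-mapsTo k (maps x∈C)

  iterate-injectiveOn : ∀ k → InjectiveOn (λ x → iterate π x k) C
  iterate-injectiveOn zero    _   _   eq = eq
  iterate-injectiveOn (suc k) x∈C y∈C eq = inj x∈C y∈C (iterate-injectiveOn k (maps x∈C) (maps y∈C) eq)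

  -- Two of x, π x, …, πⁿ x coincide, and π is cancellable on C.
  ∃-period : ∀ {x} → x ∈ C → ∃ λ k → 0 < k × k ≤ n × iterate π x k ≡ x
  ∃-period {x} x∈C with pigeonhole (n<1+n n) (λ i → iterate π x (toℕ i))
  ... | i , j , i<j , πⁱx≡πʲx =
    k , m<n⇒0<n∸m i<j , ≤-trans (m∸n≤m (toℕ j) (toℕ i)) (toℕ≤pred[n] j) , πᵏx≡x
    where
    k : ℕ
    k = toℕ j ∸ toℕ i
    πᵏx≡x : iterate π x k ≡ x
    πᵏx≡x = iterate-injectiveOn (toℕ i) (iterate-mapsTo k x∈C) x∈C (begin
      iterate π (iterate π x k) (toℕ i)  ≡⟨ iterate-+ π x k (toℕ i) ⟨
      iterate π x (k + toℕ i)            ≡⟨ cong (iterate π x) (m∸n+n≡m (<⇒≤ i<j)) ⟩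
      iterate π x (toℕ j)                ≡⟨ πⁱx≡πʲx ⟨
      iterate π x (toℕ i)                ∎)
      where open ≡-Reasoning

  iterate-n!≡id : ∀ {x} → x ∈ C → iterate π x (n !) ≡ x
  iterate-n!≡id x∈C with ∃-period x∈C
  ... | suc k , _ , k≤n , fix with ∣-trans (m∣m*n (k !)) (m≤n⇒m!∣n! k≤n)
  ...   | divides q n!≡q*k = trans (cong (iterate π _) n!≡q*k) (iterate-* π _ (suc k) fix q)

HyperMap : ℕ → Set
HyperMap n = Fin n → Subset n

_∘ₕ_ : HyperMap n → HyperMap n → HyperMap n
(g ∘ₕ f) d = ⟦ (λ y → any? (λ e → (e ∈? f d) ×-dec (y ∈? g e))) ⟧

module _ (g f : HyperMap n) {d y : Fin n} where

  ∈-∘ₕ⁺ : ∀ {e} → e ∈ f d → y ∈ g e → y ∈ (g ∘ₕ f) d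
  ∈-∘ₕ⁺ {e} e∈fd y∈ge = ∈⟦⟧⁺ _ (e , e∈fd , y∈ge)

  ∈-∘ₕ⁻ : y ∈ (g ∘ₕ f) d → ∃ λ e → e ∈ f d × y ∈ g e
  ∈-∘ₕ⁻ = ∈⟦⟧⁻ _

Selects : HyperMap n → (Fin n → Fin n) → Subset n → Set
Selects t ψ S = ∀ {x} → x ∈ S → ψ x ∈ t x

module _ {n : ℕ} (𝒟 : Structure n) where

  ∘ₕ-isSHE : ∀ {g f : HyperMap n} → IsSHE 𝒟 g → IsSHE 𝒟 f → IsSHE 𝒟 (g ∘ₕ f)
  ∘ₕ-isSHE {g} {f} ((g-nonempty , g-onto) , g-hom) ((f-nonempty , f-onto) , f-hom) = (nonempty , onto) , hom
    where
    nonempty : ∀ d → Nonempty ((g ∘ₕ f) d)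
    nonempty d = let (e , e∈fd) = f-nonempty d ; (y , y∈ge) = g-nonempty e in y , ∈-∘ₕ⁺ g f e∈fd y∈ge
    onto : ∀ d → ∃ λ e → d ∈ (g ∘ₕ f) e
    onto d = let (e′ , d∈ge′) = g-onto d ; (e , e′∈fe) = f-onto e′ in e , ∈-∘ₕ⁺ g f e′∈fe d∈ge′
    hom : ∀ r (a b : Vec (Fin n) (arity 𝒟 r)) → rel 𝒟 r a ≡ true →
          (∀ j → lookup b j ∈ (g ∘ₕ f) (lookup a j)) → rel 𝒟 r b ≡ true
    hom r a b ra b∈ = g-hom r c b (f-hom r a c ra c∈) b∈′
      where
      via : ∀ j → ∃ λ e → e ∈ f (lookup a j) × lookup b j ∈ g e
      via j = ∈-∘ₕ⁻ g f (b∈ j)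
      c : Vec (Fin n) (arity 𝒟 r)
      c = tabulate (proj₁ ∘ via)
      c∈ : ∀ j → lookup c j ∈ f (lookup a j)
      c∈ j rewrite lookup∘tabulate (proj₁ ∘ via) j = proj₁ (proj₂ (via j))
      b∈′ : ∀ j → lookup b j ∈ g (lookup c j)
      b∈′ j rewrite lookup∘tabulate (proj₁ ∘ via) j = proj₂ (proj₂ (via j))

  ∘ₕ-USurjective : ∀ {g f : HyperMap n} {U} → IsShop 𝒟 g → USurjective 𝒟 f U → USurjective 𝒟 (g ∘ₕ f) U
  ∘ₕ-USurjective {g} {f} (_ , g-onto) f-onto d =
    let (e , d∈ge) = g-onto d ; (u , u∈U , e∈fu) = f-onto e in u , u∈U , ∈-∘ₕ⁺ g f e∈fu d∈ge

  ∘ₕ-XTotal : ∀ {g f : HyperMap n} {X} → IsShop 𝒟 f → XTotal 𝒟 g X → XTotal 𝒟 (g ∘ₕ f) X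
  ∘ₕ-XTotal {g} {f} (f-nonempty , _) g-total d =
    let (e , e∈fd) = f-nonempty d ; (x , x∈X , x∈ge) = g-total e in x , x∈X , ∈-∘ₕ⁺ g f e∈fd x∈ge

  HasUSurjSHE-pull : ∀ {t : HyperMap n} {V W} → IsSHE 𝒟 t →
                     (∀ {w} → w ∈ W → ∃ λ v → v ∈ V × w ∈ t v) → HasUSurjSHE 𝒟 W → HasUSurjSHE 𝒟 V
  HasUSurjSHE-pull {t} t-she covers (f , f-she , f-onto) = f ∘ₕ t , ∘ₕ-isSHE f-she t-she , λ d →
    let (w , w∈W , d∈fw) = f-onto d ; (v , v∈V , w∈tv) = covers w∈W in v , v∈V , ∈-∘ₕ⁺ f t w∈tv d∈fw

  HasXTotalSHE-push : ∀ {t : HyperMap n} {X Y} → IsSHE 𝒟 t →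
                      (∀ {x} → x ∈ X → ∃ λ y → y ∈ Y × y ∈ t x) → HasXTotalSHE 𝒟 X → HasXTotalSHE 𝒟 Y
  HasXTotalSHE-push {t} t-she meets (g , g-she , g-total) = t ∘ₕ g , ∘ₕ-isSHE t-she g-she , λ d →
    let (x , x∈X , x∈gd) = g-total d ; (y , y∈Y , y∈tx) = meets x∈X in y , y∈Y , ∈-∘ₕ⁺ t g x∈gd y∈tx

  minU-coselection-injective : ∀ {t : HyperMap n} {ψ W} → MinU 𝒟 W → IsSHE 𝒟 t →
                               (∀ {w} → w ∈ W → w ∈ t (ψ w)) → InjectiveOn ψ W
  minU-coselection-injective {ψ = ψ} {W} (W-has , W-min) t-she co = ∣p∣≤∣image∣⇒injectiveOn
    (W-min (image ψ W) (HasUSurjSHE-pull t-she (λ {w} w∈W → ψ w , ∈-image⁺ ψ W w∈W , co w∈W) W-has))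

  selection-image-hasXTotalSHE : ∀ {t : HyperMap n} {ψ X} → HasXTotalSHE 𝒟 X → IsSHE 𝒟 t →
                                 Selects t ψ X → HasXTotalSHE 𝒟 (image ψ X)
  selection-image-hasXTotalSHE {ψ = ψ} {X} X-has t-she sel =
    HasXTotalSHE-push t-she (λ {x} x∈X → ψ x , ∈-image⁺ ψ X x∈X , sel x∈X) X-has

  minX-selection-injective : ∀ {t : HyperMap n} {ψ X} → MinX 𝒟 X → IsSHE 𝒟 t → Selects t ψ X → InjectiveOn ψ X
  minX-selection-injective (X-has , X-min) t-she sel =
    ∣p∣≤∣image∣⇒injectiveOn (X-min _ (selection-image-hasXTotalSHE X-has t-she sel))

  minX-selection-image : ∀ {t : HyperMap n} {ψ X} → MinX 𝒟 X → IsSHE 𝒟 t → Selects t ψ X → MinX 𝒟 (image ψ X)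
  minX-selection-image {ψ = ψ} {X} (X-has , X-min) t-she sel =
    selection-image-hasXTotalSHE X-has t-she sel , λ X′ X′-has → ≤-trans (∣image∣≤∣p∣ ψ X) (X-min X′ X′-has)

  Holds : ∀ r → Vec (Fin n) (arity 𝒟 r) → Set
  Holds r v = rel 𝒟 r v ≡ true

  record HyperEmbedding (C C′ : Subset n) : Set where
    field
      hyper     : HyperMap n
      hyper-SHE : IsSHE 𝒟 hyper
      fun       : Fin n → Fin n
      mapsTo    : MapsTo fun C C′
      injective : InjectiveOn fun C
      selects   : Selects hyper fun C

    lift : El 𝒟 C → El 𝒟 C′
    lift x = fun (proj₁ x) , mapsTo (proj₂ x)

    preserves : ∀ r (a : Vec (El 𝒟 C) (arity 𝒟 r)) → Holds r (map proj₁ a) → Holds r (map (fun ∘ proj₁) a)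
    preserves r a h = proj₂ hyper-SHE r (map proj₁ a) (map (fun ∘ proj₁) a) h λ j →
      subst₂ (λ y z → y ∈ hyper z) (sym (lookup-map j (fun ∘ proj₁) a)) (sym (lookup-map j proj₁ a))
        (selects (proj₂ (lookup a j)))

    map-lift : ∀ {k} (a : Vec (El 𝒟 C) k) → map (fun ∘ proj₁) a ≡ map proj₁ (map lift a)
    map-lift = map-∘ proj₁ lift

  open HyperEmbedding

  ∘-embedding : ∀ {C C′ C″} → HyperEmbedding C′ C″ → HyperEmbedding C C′ → HyperEmbedding C C″
  ∘-embedding e′ e = record
    { hyper     = hyper e′ ∘ₕ hyper e
    ; hyper-SHE = ∘ₕ-isSHE (hyper-SHE e′) (hyper-SHE e)
    ; fun       = fun e′ ∘ fun e
    ; mapsTo    = mapsTo e′ ∘ mapsTo e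
    ; injective = λ x∈ y∈ → injective e x∈ y∈ ∘ injective e′ (mapsTo e x∈) (mapsTo e y∈)
    ; selects   = λ x∈ → ∈-∘ₕ⁺ (hyper e′) (hyper e) (selects e x∈) (selects e′ (mapsTo e x∈))
    }

  ∘-embedding-preserves : ∀ {C C′} (e′ : HyperEmbedding C′ C) (e : HyperEmbedding C C′)
                          r (a : Vec (El 𝒟 C) (arity 𝒟 r)) →
                          Holds r (map (fun e ∘ proj₁) a) → Holds r (map (fun e′ ∘ fun e ∘ proj₁) a)
  ∘-embedding-preserves e′ e r a h = subst (Holds r) (sym (map-∘ (fun e′ ∘ proj₁) (lift e) a))
    (preserves e′ r (map (lift e) a) (subst (Holds r) (map-lift e a) h))

  -- Iterating a self-embedding preserves relations, and its (n !)-th iterate is the identity on C.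
  self-embedding-reflects : ∀ {C} (e : HyperEmbedding C C) r (a : Vec (El 𝒟 C) (arity 𝒟 r)) →
                            Holds r (map (fun e ∘ proj₁) a) → Holds r (map proj₁ a)
  self-embedding-reflects e r a h =
    subst (Holds r) iterate-returns (iterate-preserves K (map (lift e) a) (subst (Holds r) (map-lift e a) h))
    where
    π : Fin n → Fin n
    π = fun e
    iterate-preserves : ∀ k a → Holds r (map proj₁ a) → Holds r (map (λ x → iterate π (proj₁ x) k) a)
    iterate-preserves zero    a h = h
    iterate-preserves (suc k) a h = subst (Holds r) (sym (map-∘ _ (lift e) a))
      (iterate-preserves k (map (lift e) a) (subst (Holds r) (map-lift e a) (preserves e r a h)))
    K : ℕ
    K = pred (n !)
    iterate-returns : map (λ x → iterate π (proj₁ x) K) (map (lift e) a) ≡ map proj₁ a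
    iterate-returns = begin
      map (λ x → iterate π (proj₁ x) K) (map (lift e) a)  ≡⟨ map-∘ _ (lift e) a ⟨
      map (λ x → iterate π (proj₁ x) (suc K)) a         ≡⟨ cong (λ N → map (λ x → iterate π (proj₁ x) N) a)
                                                               (suc-pred (n !) {{n !≢0}}) ⟩
      map (λ x → iterate π (proj₁ x) (n !)) a           ≡⟨ map-cong (λ x → iterate-n!≡id (mapsTo e) (injective e) (proj₂ x)) a ⟩
      map proj₁ a                                       ∎
      where open ≡-Reasoning

  embeddings⇒iso : ∀ {C C′} → HyperEmbedding C C′ → HyperEmbedding C′ C → InducedIso 𝒟 C C′
  embeddings⇒iso {C} {C′} e e′ = record
    { to        = lift e
    ; from      = λ y → proj₁ (onto (proj₂ y)) , proj₁ (proj₂ (onto (proj₂ y)))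
    ; from-to   = λ x → let (_ , c∈C , fc≡fx) = onto (mapsTo e (proj₂ x)) in injective e c∈C (proj₂ x) fc≡fx
    ; to-from   = λ y → proj₂ (proj₂ (onto (proj₂ y)))
    ; preserves = λ r a → ⇔→≡ {z = true} (mk⇔
        (preserves e r a)
        (self-embedding-reflects (∘-embedding e′ e) r a ∘ ∘-embedding-preserves e′ e r a))
    }
    where
    onto : ∀ {y} → y ∈ C′ → ∃ λ x → x ∈ C × fun e x ≡ y
    onto = ∈-image⁻ (fun e) C ∘ injectiveOn∧∣q∣≤∣p∣⇒q⊆image (mapsTo e) (injective e)
      (injectiveOn⇒∣p∣≤∣q∣ (mapsTo e′) (injective e′))

  module UXEmbedding {U X U′ X′ : Subset n} (choice : IsUXChoice 𝒟 U X) (minU′ : MinU 𝒟 U′)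
                    {s : HyperMap n} (s-she : IsSHE 𝒟 s) (s-onto : USurjective 𝒟 s U) (s-total : XTotal 𝒟 s X′) where

    minU : MinU 𝒟 U
    minU = proj₁ choice

    minX : MinX 𝒟 X
    minX = proj₁ (proj₂ choice)

    target? : ∀ u → Decidable (λ u′ → u′ ∈ U′ × u′ ∈ s u)
    target? u u′ = (u′ ∈? U′) ×-dec (u′ ∈? s u)

    ρ : Fin n → Fin n
    ρ u = choose (target? u) u

    -- Otherwise s(U - u) would still cover U′, so U - u would carry a U-surjective SHE.
    ρ-spec : ∀ {u} → u ∈ U → ρ u ∈ U′ × ρ u ∈ s u
    ρ-spec {u} u∈U = choose-satisfies (target? u) u (decidable-stable (any? (target? u)) λ ¬∃ →
      <⇒≱ (x∈p⇒∣p-x∣<∣p∣ u∈U) (proj₂ minU (U - u) (HasUSurjSHE-pull s-she (covers ¬∃) (proj₁ minU′))))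
      where
      covers : ¬ (∃ λ u′ → u′ ∈ U′ × u′ ∈ s u) → ∀ {w} → w ∈ U′ → ∃ λ v → v ∈ U - u × w ∈ s v
      covers ¬∃ {w} w∈U′ =
        let (v , v∈U , w∈sv) = s-onto w in v , x∈p∧x≢y⇒x∈p-y v∈U (λ { refl → ¬∃ (w , w∈U′ , w∈sv) }) , w∈sv

    -- Any choice U′ → U of preimages under s that sends s u ∩ U′ to u is injective, by minimality of U′.
    ρ-unique : ∀ {u w} → u ∈ U → w ∈ U′ → w ∈ s u → w ≡ ρ u
    ρ-unique {u} u∈U w∈U′ w∈su =
      minU-coselection-injective minU′ s-she back-covers w∈U′ (proj₁ (ρ-spec u∈U))
        (trans (back-u w∈su) (sym (back-u (proj₂ (ρ-spec u∈U)))))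
      where
      back : Fin n → Fin n
      back x with x ∈? s u
      ... | yes _ = u
      ... | no  _ = proj₁ (s-onto x)
      back-covers : ∀ {x} → x ∈ U′ → x ∈ s (back x)
      back-covers {x} _ with x ∈? s u
      ... | yes x∈su = x∈su
      ... | no  _    = proj₂ (proj₂ (s-onto x))
      back-u : ∀ {x} → x ∈ s u → back x ≡ u
      back-u {x} x∈su with x ∈? s u
      ... | yes _    = refl
      ... | no x∉su  = contradiction x∈su x∉su

    ρ-injective : InjectiveOn ρ U
    ρ-injective = ∣p∣≤∣image∣⇒injectiveOn (≤-trans (proj₂ minU U′ (proj₁ minU′)) (p⊆q⇒∣p∣≤∣q∣ U′⊆image))
      where
      U′⊆image : U′ ⊆ image ρ U
      U′⊆image {w} w∈U′ = let (v , v∈U , w∈sv) = s-onto w in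
        subst (_∈ image ρ U) (sym (ρ-unique v∈U w∈U′ w∈sv)) (∈-image⁺ ρ U v∈U)

    σ : Fin n → Fin n
    σ x with x ∈? U
    ... | yes _ = ρ x
    ... | no  _ = proj₁ (s-total x)

    σ-selects : ∀ {S} → Selects s σ S
    σ-selects {x = x} _ with x ∈? U
    ... | yes x∈U = proj₂ (ρ-spec x∈U)
    ... | no  _   = proj₂ (proj₂ (s-total x))

    σ-mapsTo : MapsTo σ (U ∪ X) (U′ ∪ X′)
    σ-mapsTo {x} _ with x ∈? U
    ... | yes x∈U = x∈p∪q⁺ (inj₁ (proj₁ (ρ-spec x∈U)))
    ... | no  _   = x∈p∪q⁺ (inj₂ (proj₁ (proj₂ (s-total x))))

    σ-on-U : ∀ {x} → x ∈ U → σ x ≡ ρ x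
    σ-on-U {x} x∈U with x ∈? U
    ... | yes _   = refl
    ... | no  x∉U = contradiction x∈U x∉U

    σ-U⊆U′ : ∀ {x} → x ∈ U → σ x ∈ U′
    σ-U⊆U′ x∈U = subst (_∈ U′) (sym (σ-on-U x∈U)) (proj₁ (ρ-spec x∈U))

    σ-injectiveOn-X : InjectiveOn σ X
    σ-injectiveOn-X = minX-selection-injective minX s-she σ-selects

    -- Otherwise σ embeds (U ∩ X) ∪ {x} into U′ ∩ σ(X), where σ(X) is a minimum X-total set:
    -- this contradicts the maximality of ∣ U ∩ X ∣.
    σ⁻¹U′∩X⊆U : ∀ {x} → x ∈ X → σ x ∈ U′ → x ∈ U
    σ⁻¹U′∩X⊆U {x} x∈X σx∈U′ = decidable-stable (x ∈? U) λ x∉U →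
      <⇒≱ (p⊂q⇒∣p∣<∣q∣ (U∩X⊂B x∉U))
          (≤-trans (injectiveOn⇒∣p∣≤∣q∣ B-mapsTo (λ a∈ b∈ → σ-injectiveOn-X (B⊆X a∈) (B⊆X b∈)))
                   (proj₂ (proj₂ choice) U′ (image σ X) minU′ (minX-selection-image minX s-she σ-selects)))
      where
      B : Subset n
      B = (U ∩ X) ∪ ⁅ x ⁆
      U∩X⊂B : x ∉ U → U ∩ X ⊂ B
      U∩X⊂B x∉U = p⊆p∪q ⁅ x ⁆ , x , x∈p∪q⁺ (inj₂ (x∈⁅x⁆ x)) , x∉U ∘ proj₁ ∘ x∈p∩q⁻ U X
      B⊆X : B ⊆ X
      B⊆X z∈B with x∈p∪q⁻ (U ∩ X) ⁅ x ⁆ z∈B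
      ... | inj₁ z∈U∩X = proj₂ (x∈p∩q⁻ U X z∈U∩X)
      ... | inj₂ z∈⁅x⁆ = subst (_∈ X) (sym (x∈⁅y⁆⇒x≡y x z∈⁅x⁆)) x∈X
      B-mapsTo : MapsTo σ B (U′ ∩ image σ X)
      B-mapsTo {z} z∈B = x∈p∩q⁺ (σz∈U′ , ∈-image⁺ σ X (B⊆X z∈B))
        where
        σz∈U′ : σ z ∈ U′
        σz∈U′ with x∈p∪q⁻ (U ∩ X) ⁅ x ⁆ z∈B
        ... | inj₁ z∈U∩X = σ-U⊆U′ (proj₁ (x∈p∩q⁻ U X z∈U∩X))
        ... | inj₂ z∈⁅x⁆ = subst (λ y → σ y ∈ U′) (sym (x∈⁅y⁆⇒x≡y x z∈⁅x⁆)) σx∈U′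

    U∪X∖U⊆X : ∀ {z} → z ∈ U ∪ X → z ∉ U → z ∈ X
    U∪X∖U⊆X z∈ z∉U with x∈p∪q⁻ U X z∈
    ... | inj₁ z∈U = contradiction z∈U z∉U
    ... | inj₂ z∈X = z∈X

    σ-injective : InjectiveOn σ (U ∪ X)
    σ-injective {a} {b} a∈ b∈ σa≡σb with toSum (a ∈? U) | toSum (b ∈? U)
    ... | inj₁ a∈U | inj₁ b∈U = ρ-injective a∈U b∈U (trans (sym (σ-on-U a∈U)) (trans σa≡σb (σ-on-U b∈U)))
    ... | inj₁ a∈U | inj₂ b∉U =
      contradiction (σ⁻¹U′∩X⊆U (U∪X∖U⊆X b∈ b∉U) (subst (_∈ U′) σa≡σb (σ-U⊆U′ a∈U))) b∉U
    ... | inj₂ a∉U | inj₁ b∈U =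
      contradiction (σ⁻¹U′∩X⊆U (U∪X∖U⊆X a∈ a∉U) (subst (_∈ U′) (sym σa≡σb) (σ-U⊆U′ b∈U))) a∉U
    ... | inj₂ a∉U | inj₂ b∉U = σ-injectiveOn-X (U∪X∖U⊆X a∈ a∉U) (U∪X∖U⊆X b∈ b∉U) σa≡σb

    embedding : HyperEmbedding (U ∪ X) (U′ ∪ X′)
    embedding = record
      { hyper = s ; hyper-SHE = s-she ; fun = σ ; mapsTo = σ-mapsTo ; injective = σ-injective ; selects = σ-selects }

  uxChoice-embedding : ∀ {U X U′ X′} → IsUXChoice 𝒟 U X → IsUXChoice 𝒟 U′ X′ →
                       HyperEmbedding (U ∪ X) (U′ ∪ X′)
  uxChoice-embedding choice@(((f , f-she , f-onto) , _) , _) (minU′ , ((g , g-she , g-total) , _) , _) =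
    UXEmbedding.embedding choice minU′ (∘ₕ-isSHE g-she f-she) (∘ₕ-USurjective (proj₁ g-she) f-onto)
      (∘ₕ-XTotal (proj₁ f-she) g-total)

theorem4 : ∀ {n : ℕ} (𝒟 : Structure n) → 0 < n →
    ∀ (U X U′ X′ : Subset n) →
    IsUXChoice 𝒟 U X → IsUXChoice 𝒟 U′ X′ →
    InducedIso 𝒟 (U ∪ X) (U′ ∪ X′)
theorem4 𝒟 _ U X U′ X′ choice choice′ =
  embeddings⇒iso 𝒟 (uxChoice-embedding 𝒟 choice choice′) (uxChoice-embedding 𝒟 choice′ choice)
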